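{- Let $\overline{p}(n)$ denote the number of overpartitions of $n$. If $a,b$ are positive integers with $a\ge b$, then \[\overline{p}(a)\,\overline{p}(b)>\overline{p}(a+b),\] except for $(a,b)=(1,1),(2,1)$.
   Context: An overpartition of a nonnegative integer $n$ is a partition of $n$ (a non-increasing sequence of positive integers summing to $n$) in which the last occurrence of each distinct part may be overlined. $\overline{p}(n)$ is the number of overpartitions of $n$; equivalently $\sum_{n\ge0}\overline{p}(n)q^n=\prod_{n\ge1}\frac{1+q^n}{1-q^n}$. -}

module Defs where

open import Data.Nat using (ℕ; zero; suc; _+_; _*_; _∸_; _≤ᵇ_)
open import Data.Bool using (if_then_else_)

-- An overpartition of n: a partition of n in which the last occurrence of
-- each distinct part may be overlined.  We count them by the size of parts:
-- for each part size k, choose a multiplicity m; if m ≥ 1 there are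
-- exactly 2 choices (last occurrence of k overlined or not), if m = 0 one.

-- opb n k = number of overpartitions of n all of whose parts are ≤ k.
-- mults f k n r : sum over multiplicities m = 1 .. (bounded by fuel r) with
--   m * k ≤ n of  f (n ∸ m * k).
mults : (ℕ → ℕ) → ℕ → ℕ → ℕ → ℕ
mults f k n zero = 0
mults f k n (suc r) =
  (if suc r * k ≤ᵇ n then f (n ∸ suc r * k) else 0) + mults f k n r

opb : ℕ → ℕ → ℕ
opb zero    zero    = 1
opb (suc n) zero    = 0
opb n       (suc k) = opb n k + 2 * mults (λ j → opb j k) (suc k) n n

overpartitions : ℕ → ℕ
overpartitions n = opb n n

module Submission where

-- The generating function of overpartitions into parts ≤ K is ∏_{k ≤ K} (1 + qᵏ) / (1 - qᵏ).
-- Comparing coefficients of its logarithmic derivative gives n p̄(n) = ∑_{t ≤ n} σ(t) p̄(n - t),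
-- where σ(t) is the sum of 2d over the divisors d of t with t/d odd, so 2t ≤ σ(t) ≤ t(t + 1).
-- With p̄(m + 1) ≥ p̄(m) + 2 the recurrence yields 2 p̄(a) > (a + 1)(a + 2) for a ≥ 5, hence
-- σ(a + 1 + i) < p̄(a) σ(1 + i) for i < a.  Split the recurrence for (a + b) p̄(a + b) at t = a:
-- by strong induction p̄(x + y) ≤ p̄(x) p̄(y) bounds the first part by a p̄(a) p̄(b), and the bound
-- on σ makes the second part smaller than p̄(a) · b p̄(b).  The pairs with a ≤ 4 are computed.

open import Defs
open import Data.Nat
  using (ℕ; zero; suc; _+_; _*_; _∸_; _≤_; _<_; _>_; z≤n; s≤s; _≤?_; _≤ᵇ_; _≡ᵇ_; NonZero; >-nonZero)
open import Data.Nat.Properties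
open import Data.Nat.Tactic.RingSolver using (solve-∀)
open import Algebra.Properties.CommutativeSemigroup +-commutativeSemigroup using (interchange)
open import Algebra.Properties.CommutativeSemigroup *-commutativeSemigroup using () renaming (x∙yz≈y∙xz to *-left-comm)
open import Data.Bool using (true; false; if_then_else_)
open import Data.Bool.Properties using (if-float; if-eta; if-swap-then)
open import Data.Product using (_,_)
open import Data.Sum using (_⊎_; inj₁; inj₂)
open import Data.Unit using (tt)
open import Relation.Nullary using (¬_; yes; no; contradiction)
open import Relation.Nullary.Reflects using (Reflects; ofʸ; ofⁿ; fromEquivalence)
open import Relation.Binary.PropositionalEquality
open import Relation.Binary.Definitions using (tri<; tri≈; tri>)

-- Finite sums

∑≤ : ℕ → (ℕ → ℕ) → ℕ
∑≤ zero    f = f 0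
∑≤ (suc n) f = ∑≤ n f + f (suc n)

infixl 10 ∑≤
syntax ∑≤ n (λ i → e) = ∑[ i ≤ n ] e

module _ {F G : ℕ → ℕ} where

  ∑-cong : ∀ n → (∀ i → i ≤ n → F i ≡ G i) → ∑≤ n F ≡ ∑≤ n G
  ∑-cong zero    eq = eq 0 z≤n
  ∑-cong (suc n) eq = cong₂ _+_ (∑-cong n (λ i i≤n → eq i (m≤n⇒m≤1+n i≤n))) (eq (suc n) ≤-refl)

  ∑-mono-≤ : ∀ n → (∀ i → i ≤ n → F i ≤ G i) → ∑≤ n F ≤ ∑≤ n G
  ∑-mono-≤ zero    le = le 0 z≤n
  ∑-mono-≤ (suc n) le = +-mono-≤ (∑-mono-≤ n (λ i i≤n → le i (m≤n⇒m≤1+n i≤n))) (le (suc n) ≤-refl)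

  ∑-mono-< : ∀ n → (∀ i → i ≤ n → F i < G i) → ∑≤ n F < ∑≤ n G
  ∑-mono-< zero    lt = lt 0 z≤n
  ∑-mono-< (suc n) lt = +-mono-< (∑-mono-< n (λ i i≤n → lt i (m≤n⇒m≤1+n i≤n))) (lt (suc n) ≤-refl)

  ∑-distrib-+ : ∀ n → ∑[ i ≤ n ] (F i + G i) ≡ ∑≤ n F + ∑≤ n G
  ∑-distrib-+ zero    = refl
  ∑-distrib-+ (suc n) = begin
    ∑[ i ≤ n ] (F i + G i) + (F (suc n) + G (suc n))  ≡⟨ cong (_+ (F (suc n) + G (suc n))) (∑-distrib-+ n) ⟩
    ∑≤ n F + ∑≤ n G + (F (suc n) + G (suc n))         ≡⟨ interchange (∑≤ n F) (∑≤ n G) _ _ ⟩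
    ∑≤ n F + F (suc n) + (∑≤ n G + G (suc n))         ∎
    where open ≡-Reasoning

∑-zero : ∀ n {F : ℕ → ℕ} → (∀ i → i ≤ n → F i ≡ 0) → ∑≤ n F ≡ 0
∑-zero n eq = trans (∑-cong n eq) (∑-const-0 n)
  where
  ∑-const-0 : ∀ n → ∑[ i ≤ n ] 0 ≡ 0
  ∑-const-0 zero    = refl
  ∑-const-0 (suc n) = cong (_+ 0) (∑-const-0 n)

∑-distribˡ : ∀ n a (F : ℕ → ℕ) → a * ∑≤ n F ≡ ∑[ i ≤ n ] (a * F i)
∑-distribˡ zero    a F = refl
∑-distribˡ (suc n) a F = trans (*-distribˡ-+ a (∑≤ n F) (F (suc n))) (cong (_+ a * F (suc n)) (∑-distribˡ n a F))

∑-distribʳ : ∀ n a (F : ℕ → ℕ) → ∑≤ n F * a ≡ ∑[ i ≤ n ] (F i * a)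
∑-distribʳ zero    a F = refl
∑-distribʳ (suc n) a F = trans (*-distribʳ-+ a (∑≤ n F) (F (suc n))) (cong (_+ F (suc n) * a) (∑-distribʳ n a F))

∑-head : ∀ n (F : ℕ → ℕ) → ∑≤ (suc n) F ≡ F 0 + ∑[ i ≤ n ] F (suc i)
∑-head zero    F = refl
∑-head (suc n) F = trans (cong (_+ F (suc (suc n))) (∑-head n F)) (+-assoc (F 0) _ _)

∑-split : ∀ a b (F : ℕ → ℕ) → ∑≤ (a + suc b) F ≡ ∑≤ a F + ∑[ i ≤ b ] F (a + suc i)
∑-split a zero    F rewrite +-comm a 1 = refl
∑-split a (suc b) F = begin
  ∑≤ (a + suc (suc b)) F                     ≡⟨ cong (λ m → ∑≤ m F) (+-suc a (suc b)) ⟩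
  ∑≤ (suc (a + suc b)) F                     ≡⟨ cong (_+ F (suc (a + suc b))) (∑-split a b F) ⟩
  ∑≤ a F + ∑[ i ≤ b ] F (a + suc i) + F (suc (a + suc b))
    ≡⟨ +-assoc (∑≤ a F) _ _ ⟩
  ∑≤ a F + (∑[ i ≤ b ] F (a + suc i) + F (suc (a + suc b)))
    ≡⟨ cong (λ m → ∑≤ a F + (∑[ i ≤ b ] F (a + suc i) + F m)) (sym (+-suc a (suc b))) ⟩
  ∑≤ a F + ∑[ i ≤ suc b ] F (a + suc i)     ∎
  where open ≡-Reasoning

∑-extend : ∀ {n} M (F : ℕ → ℕ) → n ≤ M → (∀ i → n < i → F i ≡ 0) → ∑≤ M F ≡ ∑≤ n F
∑-extend zero    F z≤n     _     = refl
∑-extend (suc M) F n≤1+M zeros with m≤n⇒m<n∨m≡n n≤1+M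
... | inj₂ refl  = refl
... | inj₁ n<1+M = trans (cong₂ _+_ (∑-extend M F (≤-pred n<1+M) zeros) (zeros (suc M) n<1+M)) (+-identityʳ _)

∑-comm : ∀ n m (F : ℕ → ℕ → ℕ) → ∑[ i ≤ n ] ∑[ j ≤ m ] F i j ≡ ∑[ j ≤ m ] ∑[ i ≤ n ] F i j
∑-comm zero    m F = refl
∑-comm (suc n) m F = trans (cong (_+ ∑[ j ≤ m ] F (suc n) j) (∑-comm n m F)) (sym (∑-distrib-+ m))

∑-term-≤ : ∀ n {i} (F : ℕ → ℕ) → i ≤ n → F i ≤ ∑≤ n F
∑-term-≤ zero    F z≤n = ≤-refl
∑-term-≤ (suc n) F i≤1+n with m≤n⇒m<n∨m≡n i≤1+n
... | inj₁ i<1+n = ≤-trans (∑-term-≤ n F (≤-pred i<1+n)) (m≤m+n _ _)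
... | inj₂ refl  = m≤n+m _ _

if-≤ᵇ : ∀ {m n} {v w : ℕ} → m ≤ n → (if m ≤ᵇ n then v else w) ≡ v
if-≤ᵇ {m} {n} m≤n with m ≤ᵇ n | ≤ᵇ-reflects-≤ m n
... | true  | _        = refl
... | false | ofⁿ m≰n = contradiction m≤n m≰n

if-≰ᵇ : ∀ {m n} {v w : ℕ} → ¬ m ≤ n → (if m ≤ᵇ n then v else w) ≡ w
if-≰ᵇ {m} {n} m≰n with m ≤ᵇ n | ≤ᵇ-reflects-≤ m n
... | true  | ofʸ m≤n = contradiction m≤n m≰n
... | false | _       = refl

≡ᵇ-reflects-≡ : ∀ m n → Reflects (m ≡ n) (m ≡ᵇ n)
≡ᵇ-reflects-≡ m n = fromEquivalence (≡ᵇ⇒≡ m n) (≡⇒≡ᵇ m n)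

if-≢ᵇ : ∀ {m n} {v w : ℕ} → m ≢ n → (if m ≡ᵇ n then v else w) ≡ w
if-≢ᵇ {m} {n} m≢n with m ≡ᵇ n | ≡ᵇ-reflects-≡ m n
... | true  | ofʸ m≡n = contradiction m≡n m≢n
... | false | _       = refl

if-≡ᵇ : ∀ {m n} {v w : ℕ} → m ≡ n → (if m ≡ᵇ n then v else w) ≡ v
if-≡ᵇ {m} {n} m≡n with m ≡ᵇ n | ≡ᵇ-reflects-≡ m n
... | true  | _        = refl
... | false | ofⁿ m≢n = contradiction m≡n m≢n

∑-delta : ∀ n c (F : ℕ → ℕ) → ∑[ t ≤ n ] (if c ≡ᵇ t then F t else 0) ≡ (if c ≤ᵇ n then F c else 0)
∑-delta zero    zero    F = refl
∑-delta zero    (suc c) F = refl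
∑-delta (suc n) c       F with <-cmp c (suc n)
... | tri< c<1+n c≢1+n _ = trans (cong₂ _+_ (trans (∑-delta n c F) (if-≤ᵇ (≤-pred c<1+n))) (if-≢ᵇ c≢1+n))
                                 (trans (+-identityʳ (F c)) (sym (if-≤ᵇ (<⇒≤ c<1+n))))
... | tri≈ _ refl _      = trans (cong₂ _+_ (trans (∑-delta n c F) (if-≰ᵇ {suc n} (1+n≰n {n}))) (if-≡ᵇ {suc n} refl))
                                 (sym (if-≤ᵇ {suc n} ≤-refl))
... | tri> _ c≢1+n 1+n<c = trans (cong₂ _+_ (trans (∑-delta n c F) (if-≰ᵇ (<⇒≱ (<-trans (n<1+n n) 1+n<c))))
                                            (if-≢ᵇ c≢1+n))
                                 (sym (if-≰ᵇ (<⇒≱ 1+n<c)))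

≤ᵇ-suc : ∀ m n → (suc m ≤ᵇ suc n) ≡ (m ≤ᵇ n)
≤ᵇ-suc zero    n = refl
≤ᵇ-suc (suc m) n = refl

∑-reindex : ∀ d n (Ψ : ℕ → ℕ) →
  ∑[ m ≤ n ] (if d ≤ᵇ m then Ψ m else 0) ≡ ∑[ e ≤ n ] (if d + e ≤ᵇ n then Ψ (d + e) else 0)
∑-reindex zero    n       Ψ = ∑-cong n λ e e≤n → sym (if-≤ᵇ e≤n)
∑-reindex (suc d) zero    Ψ = refl
∑-reindex (suc d) (suc n) Ψ = begin
  ∑[ m ≤ suc n ] (if suc d ≤ᵇ m then Ψ m else 0)
    ≡⟨ ∑-head n _ ⟩
  ∑[ m ≤ n ] (if suc d ≤ᵇ suc m then Ψ (suc m) else 0)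
    ≡⟨ ∑-cong n (λ m _ → cong (λ b → if b then Ψ (suc m) else 0) (≤ᵇ-suc d m)) ⟩
  ∑[ m ≤ n ] (if d ≤ᵇ m then Ψ (suc m) else 0)
    ≡⟨ ∑-reindex d n (λ m → Ψ (suc m)) ⟩
  ∑[ e ≤ n ] (if d + e ≤ᵇ n then Ψ (suc d + e) else 0)
    ≡⟨ ∑-cong n (λ e _ → cong (λ b → if b then Ψ (suc d + e) else 0) (≤ᵇ-suc (d + e) n)) ⟨
  ∑[ e ≤ n ] (if suc d + e ≤ᵇ suc n then Ψ (suc d + e) else 0)
    ≡⟨ +-identityʳ _ ⟨
  ∑[ e ≤ n ] (if suc d + e ≤ᵇ suc n then Ψ (suc d + e) else 0) + 0
    ≡⟨ cong (∑[ e ≤ n ] (if suc d + e ≤ᵇ suc n then Ψ (suc d + e) else 0) +_)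
            (if-≰ᵇ {suc d + suc n} (<⇒≱ (m<n+m (suc n) (s≤s z≤n)))) ⟨
  ∑[ e ≤ suc n ] (if suc d + e ≤ᵇ suc n then Ψ (suc d + e) else 0)  ∎
  where open ≡-Reasoning

-- Coefficients of products of power series

-- For k ≥ 1, dconv k x h n is the coefficient of qⁿ in x(qᵏ) h(q).
dconv : ℕ → (ℕ → ℕ) → (ℕ → ℕ) → ℕ → ℕ
dconv k x h n = ∑[ m ≤ n ] (if m * k ≤ᵇ n then x m * h (n ∸ m * k) else 0)

conv : (ℕ → ℕ) → (ℕ → ℕ) → ℕ → ℕ
conv f h n = ∑[ t ≤ n ] (f t * h (n ∸ t))

dil : ℕ → (ℕ → ℕ) → ℕ → ℕ
dil k x t = ∑[ d ≤ t ] (if d * k ≡ᵇ t then x d else 0)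

dconv-congʳ : ∀ k x {h h′ : ℕ → ℕ} n → (∀ t → t ≤ n → h t ≡ h′ t) → dconv k x h n ≡ dconv k x h′ n
dconv-congʳ k x n eq = ∑-cong n λ m _ →
  cong (λ v → if m * k ≤ᵇ n then x m * v else 0) (eq (n ∸ m * k) (m∸n≤m n (m * k)))

dconv-congˡ : ∀ k {x x′ : ℕ → ℕ} h n → (∀ m → m ≤ n → x m ≡ x′ m) → dconv k x h n ≡ dconv k x′ h n
dconv-congˡ k h n eq = ∑-cong n λ m m≤n →
  cong (λ v → if m * k ≤ᵇ n then v * h (n ∸ m * k) else 0) (eq m m≤n)

dconv-leibniz : ∀ k x h n →
  n * dconv k x h n ≡ dconv k x (λ t → t * h t) n + k * dconv k (λ m → m * x m) h n
dconv-leibniz k x h n = begin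
  n * dconv k x h n
    ≡⟨ ∑-distribˡ n n _ ⟩
  ∑[ m ≤ n ] (n * (if m * k ≤ᵇ n then x m * h (n ∸ m * k) else 0))
    ≡⟨ ∑-cong n (λ m _ → termwise m) ⟩
  ∑[ m ≤ n ] ((if m * k ≤ᵇ n then x m * ((n ∸ m * k) * h (n ∸ m * k)) else 0)
             + k * (if m * k ≤ᵇ n then m * x m * h (n ∸ m * k) else 0))
    ≡⟨ ∑-distrib-+ n ⟩
  dconv k x (λ t → t * h t) n + ∑[ m ≤ n ] (k * (if m * k ≤ᵇ n then m * x m * h (n ∸ m * k) else 0))
    ≡⟨ cong (dconv k x (λ t → t * h t) n +_) (sym (∑-distribˡ n k _)) ⟩
  dconv k x (λ t → t * h t) n + k * dconv k (λ m → m * x m) h n  ∎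
  where
  open ≡-Reasoning
  split-weight : ∀ r m k xm hr → (r + m * k) * (xm * hr) ≡ xm * (r * hr) + k * (m * xm * hr)
  split-weight = solve-∀
  termwise : ∀ m → n * (if m * k ≤ᵇ n then x m * h (n ∸ m * k) else 0)
                 ≡ (if m * k ≤ᵇ n then x m * ((n ∸ m * k) * h (n ∸ m * k)) else 0)
                   + k * (if m * k ≤ᵇ n then m * x m * h (n ∸ m * k) else 0)
  termwise m with m * k ≤ᵇ n | ≤ᵇ-reflects-≤ (m * k) n
  ... | true  | ofʸ mk≤n = trans (cong (_* (x m * h (n ∸ m * k))) (sym (m∸n+n≡m mk≤n)))
                                 (split-weight (n ∸ m * k) m k (x m) (h (n ∸ m * k)))
  ... | false | _        = trans (*-zeroʳ n) (sym (*-zeroʳ k))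

dconv-as-double-sum : ∀ k j .{{_ : NonZero j}} x y h n →
  dconv k x (dconv j y h) n
  ≡ ∑[ m ≤ n ] ∑[ e ≤ n ] (if m * k + e * j ≤ᵇ n then x m * (y e * h (n ∸ (m * k + e * j))) else 0)
dconv-as-double-sum k j x y h n = ∑-cong n λ m _ → row m
  where
  row : ∀ m → (if m * k ≤ᵇ n then x m * dconv j y h (n ∸ m * k) else 0)
            ≡ ∑[ e ≤ n ] (if m * k + e * j ≤ᵇ n then x m * (y e * h (n ∸ (m * k + e * j))) else 0)
  row m with m * k ≤ᵇ n | ≤ᵇ-reflects-≤ (m * k) n
  ... | false | ofⁿ mk≰n = sym (∑-zero n λ e _ → if-≰ᵇ (λ le → mk≰n (≤-trans (m≤m+n (m * k) (e * j)) le)))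
  ... | true  | ofʸ mk≤n = begin
    x m * dconv j y h (n ∸ m * k)
      ≡⟨ ∑-distribˡ (n ∸ m * k) (x m) _ ⟩
    ∑[ e ≤ n ∸ m * k ] (x m * (if e * j ≤ᵇ n ∸ m * k then y e * h (n ∸ m * k ∸ e * j) else 0))
      ≡⟨ ∑-extend n _ (m∸n≤m n (m * k)) beyond ⟨
    ∑[ e ≤ n ] (x m * (if e * j ≤ᵇ n ∸ m * k then y e * h (n ∸ m * k ∸ e * j) else 0))
      ≡⟨ ∑-cong n (λ e _ → cell e) ⟩
    ∑[ e ≤ n ] (if m * k + e * j ≤ᵇ n then x m * (y e * h (n ∸ (m * k + e * j))) else 0)  ∎
    where
    open ≡-Reasoning
    beyond : ∀ e → n ∸ m * k < e → x m * (if e * j ≤ᵇ n ∸ m * k then y e * h (n ∸ m * k ∸ e * j) else 0) ≡ 0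
    beyond e e> = trans (cong (x m *_) (if-≰ᵇ (<⇒≱ (<-≤-trans e> (m≤m*n e j))))) (*-zeroʳ (x m))
    cell : ∀ e → x m * (if e * j ≤ᵇ n ∸ m * k then y e * h (n ∸ m * k ∸ e * j) else 0)
               ≡ (if m * k + e * j ≤ᵇ n then x m * (y e * h (n ∸ (m * k + e * j))) else 0)
    cell e with e * j ≤ᵇ n ∸ m * k | ≤ᵇ-reflects-≤ (e * j) (n ∸ m * k)
              | m * k + e * j ≤ᵇ n | ≤ᵇ-reflects-≤ (m * k + e * j) n
    ... | true  | _       | true  | _       = cong (λ t → x m * (y e * h t)) (∸-+-assoc n (m * k) (e * j))
    ... | false | _       | false | _       = *-zeroʳ (x m)
    ... | true  | ofʸ fits | false | ofⁿ ¬fits =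
      contradiction (subst (_≤ n) (+-comm (e * j) (m * k)) (m≤o∸n⇒m+n≤o (e * j) mk≤n fits)) ¬fits
    ... | false | ofⁿ ¬fits | true  | ofʸ fits =
      contradiction (m+n≤o⇒m≤o∸n (e * j) (subst (_≤ n) (+-comm (m * k) (e * j)) fits)) ¬fits

dconv-comm : ∀ k j .{{_ : NonZero k}} .{{_ : NonZero j}} x y h n →
  dconv k x (dconv j y h) n ≡ dconv j y (dconv k x h) n
dconv-comm k j x y h n = begin
  dconv k x (dconv j y h) n
    ≡⟨ dconv-as-double-sum k j x y h n ⟩
  ∑[ m ≤ n ] ∑[ e ≤ n ] (if m * k + e * j ≤ᵇ n then x m * (y e * h (n ∸ (m * k + e * j))) else 0)
    ≡⟨ ∑-comm n n _ ⟩
  ∑[ e ≤ n ] ∑[ m ≤ n ] (if m * k + e * j ≤ᵇ n then x m * (y e * h (n ∸ (m * k + e * j))) else 0)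
    ≡⟨ ∑-cong n (λ e _ → ∑-cong n (λ m _ → cell e m)) ⟩
  ∑[ e ≤ n ] ∑[ m ≤ n ] (if e * j + m * k ≤ᵇ n then y e * (x m * h (n ∸ (e * j + m * k))) else 0)
    ≡⟨ dconv-as-double-sum j k y x h n ⟨
  dconv j y (dconv k x h) n  ∎
  where
  open ≡-Reasoning
  cell : ∀ e m → (if m * k + e * j ≤ᵇ n then x m * (y e * h (n ∸ (m * k + e * j))) else 0)
               ≡ (if e * j + m * k ≤ᵇ n then y e * (x m * h (n ∸ (e * j + m * k))) else 0)
  cell e m rewrite +-comm (m * k) (e * j) | *-left-comm (x m) (y e) (h (n ∸ (e * j + m * k))) = refl

dconv-assoc : ∀ k .{{_ : NonZero k}} x y h n → dconv k (conv x y) h n ≡ dconv k x (dconv k y h) n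
dconv-assoc k x y h n = begin
  dconv k (conv x y) h n
    ≡⟨ ∑-cong n (λ m m≤n → expand m m≤n) ⟩
  ∑[ m ≤ n ] ∑[ d ≤ n ] (if m * k ≤ᵇ n then (if d ≤ᵇ m then Φ d m else 0) else 0)
    ≡⟨ ∑-comm n n _ ⟩
  ∑[ d ≤ n ] ∑[ m ≤ n ] (if m * k ≤ᵇ n then (if d ≤ᵇ m then Φ d m else 0) else 0)
    ≡⟨ ∑-cong n (λ d _ → substitute d) ⟩
  ∑[ d ≤ n ] ∑[ e ≤ n ] (if d * k + e * k ≤ᵇ n then x d * (y e * h (n ∸ (d * k + e * k))) else 0)
    ≡⟨ dconv-as-double-sum k k x y h n ⟨
  dconv k x (dconv k y h) n  ∎
  where
  open ≡-Reasoning
  Φ : ℕ → ℕ → ℕ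
  Φ d m = x d * (y (m ∸ d) * h (n ∸ m * k))
  expand : ∀ m → m ≤ n → (if m * k ≤ᵇ n then conv x y m * h (n ∸ m * k) else 0)
         ≡ ∑[ d ≤ n ] (if m * k ≤ᵇ n then (if d ≤ᵇ m then Φ d m else 0) else 0)
  expand m m≤n with m * k ≤ᵇ n
  ... | false = sym (∑-zero n (λ _ _ → refl))
  ... | true  = begin
    conv x y m * h (n ∸ m * k)
      ≡⟨ ∑-distribʳ m _ _ ⟩
    ∑[ d ≤ m ] (x d * y (m ∸ d) * h (n ∸ m * k))
      ≡⟨ ∑-cong m (λ d d≤m → trans (*-assoc (x d) _ _) (sym (if-≤ᵇ d≤m))) ⟩
    ∑[ d ≤ m ] (if d ≤ᵇ m then Φ d m else 0)
      ≡⟨ ∑-extend n _ m≤n (λ d m<d → if-≰ᵇ (<⇒≱ m<d)) ⟨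
    ∑[ d ≤ n ] (if d ≤ᵇ m then Φ d m else 0)  ∎
  substitute : ∀ d → ∑[ m ≤ n ] (if m * k ≤ᵇ n then (if d ≤ᵇ m then Φ d m else 0) else 0)
             ≡ ∑[ e ≤ n ] (if d * k + e * k ≤ᵇ n then x d * (y e * h (n ∸ (d * k + e * k))) else 0)
  substitute d = begin
    ∑[ m ≤ n ] (if m * k ≤ᵇ n then (if d ≤ᵇ m then Φ d m else 0) else 0)
      ≡⟨ ∑-cong n (λ m _ → if-swap-then (m * k ≤ᵇ n) (d ≤ᵇ m)) ⟩
    ∑[ m ≤ n ] (if d ≤ᵇ m then (if m * k ≤ᵇ n then Φ d m else 0) else 0)
      ≡⟨ ∑-reindex d n _ ⟩
    ∑[ e ≤ n ] (if d + e ≤ᵇ n then (if (d + e) * k ≤ᵇ n then Φ d (d + e) else 0) else 0)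
      ≡⟨ ∑-cong n (λ e _ → cell e) ⟩
    ∑[ e ≤ n ] (if d * k + e * k ≤ᵇ n then x d * (y e * h (n ∸ (d * k + e * k))) else 0)  ∎
    where
    cell : ∀ e → (if d + e ≤ᵇ n then (if (d + e) * k ≤ᵇ n then Φ d (d + e) else 0) else 0)
               ≡ (if d * k + e * k ≤ᵇ n then x d * (y e * h (n ∸ (d * k + e * k))) else 0)
    cell e rewrite *-distribʳ-+ k d e | m+n∸m≡n d e
      with d * k + e * k ≤ᵇ n | ≤ᵇ-reflects-≤ (d * k + e * k) n
    ... | true  | ofʸ fits = if-≤ᵇ (≤-trans (+-mono-≤ (m≤m*n d k) (m≤m*n e k)) fits)
    ... | false | _        = if-eta (d + e ≤ᵇ n)

conv-congʳ : ∀ f {h h′ : ℕ → ℕ} n → (∀ t → t ≤ n → h t ≡ h′ t) → conv f h n ≡ conv f h′ n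
conv-congʳ f n eq = ∑-cong n λ t _ → cong (f t *_) (eq (n ∸ t) (m∸n≤m n t))

conv-linearˡ : ∀ f a g h n → conv (λ t → f t + a * g t) h n ≡ conv f h n + a * conv g h n
conv-linearˡ f a g h n = begin
  conv (λ t → f t + a * g t) h n
    ≡⟨ ∑-cong n (λ t _ → distribute (f t) a (g t) (h (n ∸ t))) ⟩
  ∑[ t ≤ n ] (f t * h (n ∸ t) + a * (g t * h (n ∸ t)))
    ≡⟨ ∑-distrib-+ n ⟩
  conv f h n + ∑[ t ≤ n ] (a * (g t * h (n ∸ t)))
    ≡⟨ cong (conv f h n +_) (∑-distribˡ n a _) ⟨
  conv f h n + a * conv g h n  ∎
  where
  open ≡-Reasoning
  distribute : ∀ u a v w → (u + a * v) * w ≡ u * w + a * (v * w)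
  distribute = solve-∀

conv-as-dconv : ∀ f h n → conv f h n ≡ dconv 1 f h n
conv-as-dconv f h n = ∑-cong n λ t t≤n → begin
  f t * h (n ∸ t)
    ≡⟨ cong (λ s → f t * h (n ∸ s)) (*-identityʳ t) ⟨
  f t * h (n ∸ t * 1)
    ≡⟨ if-≤ᵇ {t * 1} (subst (_≤ n) (sym (*-identityʳ t)) t≤n) ⟨
  (if t * 1 ≤ᵇ n then f t * h (n ∸ t * 1) else 0)  ∎
  where open ≡-Reasoning

dconv-conv-comm : ∀ k .{{_ : NonZero k}} x f h n → dconv k x (conv f h) n ≡ conv f (dconv k x h) n
dconv-conv-comm k x f h n = begin
  dconv k x (conv f h) n     ≡⟨ dconv-congʳ k x n (λ t _ → conv-as-dconv f h t) ⟩
  dconv k x (dconv 1 f h) n  ≡⟨ dconv-comm k 1 x f h n ⟩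
  dconv 1 f (dconv k x h) n  ≡⟨ conv-as-dconv f (dconv k x h) n ⟨
  conv f (dconv k x h) n     ∎
  where open ≡-Reasoning

dconv-as-conv : ∀ k .{{_ : NonZero k}} x h n → dconv k x h n ≡ conv (dil k x) h n
dconv-as-conv k x h n = begin
  dconv k x h n
    ≡⟨ ∑-cong n (λ m _ → ∑-delta n (m * k) (λ t → x m * h (n ∸ t))) ⟨
  ∑[ m ≤ n ] ∑[ t ≤ n ] (if m * k ≡ᵇ t then x m * h (n ∸ t) else 0)
    ≡⟨ ∑-comm n n _ ⟩
  ∑[ t ≤ n ] ∑[ m ≤ n ] (if m * k ≡ᵇ t then x m * h (n ∸ t) else 0)
    ≡⟨ ∑-cong n (λ t t≤n → column t t≤n) ⟩
  conv (dil k x) h n  ∎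
  where
  open ≡-Reasoning
  column : ∀ t → t ≤ n → ∑[ m ≤ n ] (if m * k ≡ᵇ t then x m * h (n ∸ t) else 0) ≡ dil k x t * h (n ∸ t)
  column t t≤n = begin
    ∑[ m ≤ n ] (if m * k ≡ᵇ t then x m * h (n ∸ t) else 0)
      ≡⟨ ∑-extend n _ t≤n (λ m t<m → if-≢ᵇ (λ mk≡t → <⇒≱ t<m (subst (m ≤_) mk≡t (m≤m*n m k)))) ⟩
    ∑[ m ≤ t ] (if m * k ≡ᵇ t then x m * h (n ∸ t) else 0)
      ≡⟨ ∑-cong t (λ m _ → if-float (_* h (n ∸ t)) (m * k ≡ᵇ t)) ⟨
    ∑[ m ≤ t ] ((if m * k ≡ᵇ t then x m else 0) * h (n ∸ t))
      ≡⟨ ∑-distribʳ t _ _ ⟨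
    dil k x t * h (n ∸ t)  ∎

dconv-mono : ∀ k x (h : ℕ → ℕ) n → (∀ t → h t ≤ h (suc t)) → dconv k x h n ≤ dconv k x h (suc n)
dconv-mono k x h n h-mono = ≤-trans (∑-mono-≤ n (λ m _ → termwise m)) (m≤m+n _ _)
  where
  termwise : ∀ m → (if m * k ≤ᵇ n then x m * h (n ∸ m * k) else 0)
                 ≤ (if m * k ≤ᵇ suc n then x m * h (suc n ∸ m * k) else 0)
  termwise m with m * k ≤ᵇ n | ≤ᵇ-reflects-≤ (m * k) n
  ... | false | _        = z≤n
  ... | true  | ofʸ mk≤n = begin
    x m * h (n ∸ m * k)        ≤⟨ *-monoʳ-≤ (x m) (h-mono (n ∸ m * k)) ⟩
    x m * h (suc (n ∸ m * k))  ≡⟨ cong (λ s → x m * h s) (+-∸-assoc 1 mk≤n) ⟨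
    x m * h (suc n ∸ m * k)    ≡⟨ if-≤ᵇ (m≤n⇒m≤1+n mk≤n) ⟨
    (if m * k ≤ᵇ suc n then x m * h (suc n ∸ m * k) else 0)  ∎
    where open ≤-Reasoning

-- The recurrence for overpartitions

-- C(q) = (1 + q) / (1 - q) = ∑ markings m qᵐ: a part occurring m > 0 times has its last
-- occurrence overlined or not.
markings : ℕ → ℕ
markings zero    = 1
markings (suc _) = 2

-- Ω(q) = q (d/dq) log C(q) = 2q / (1 - q²) = ∑ twiceOdd m qᵐ.
twiceOdd : ℕ → ℕ
twiceOdd zero          = 0
twiceOdd (suc zero)    = 2
twiceOdd (suc (suc m)) = twiceOdd m

twiceOdd-pair : ∀ m → twiceOdd m + twiceOdd (suc m) ≡ 2
twiceOdd-pair zero          = refl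
twiceOdd-pair (suc zero)    = refl
twiceOdd-pair (suc (suc m)) = twiceOdd-pair m

twiceOdd-partial : ∀ m → ∑≤ m twiceOdd * 2 + twiceOdd (suc m) ≡ suc m * 2
twiceOdd-partial zero    = refl
twiceOdd-partial (suc m) = begin
  (A + ω₁) * 2 + ω₂          ≡⟨ regroup A ω₁ ω₂ ⟩
  (A * 2 + ω₁) + (ω₁ + ω₂)   ≡⟨ cong₂ _+_ (twiceOdd-partial m) (twiceOdd-pair (suc m)) ⟩
  suc m * 2 + 2              ≡⟨ +-comm (suc m * 2) 2 ⟩
  suc (suc m) * 2            ∎
  where
  open ≡-Reasoning
  A = ∑≤ m twiceOdd
  ω₁ = twiceOdd (suc m)
  ω₂ = twiceOdd (suc (suc m))
  regroup : ∀ a b c → (a + b) * 2 + c ≡ (a * 2 + b) + (b + c)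
  regroup = solve-∀

conv-twiceOdd-markings : ∀ m → conv twiceOdd markings m ≡ m * markings m
conv-twiceOdd-markings zero    = refl
conv-twiceOdd-markings (suc m) = begin
  ∑[ d ≤ m ] (twiceOdd d * markings (suc m ∸ d)) + twiceOdd (suc m) * markings (suc m ∸ suc m)
    ≡⟨ cong₂ _+_ (∑-cong m (λ d d≤m → cong (λ s → twiceOdd d * markings s) (+-∸-assoc 1 d≤m)))
                 (cong (λ s → twiceOdd (suc m) * markings s) (n∸n≡0 m)) ⟩
  ∑[ d ≤ m ] (twiceOdd d * 2) + twiceOdd (suc m) * 1
    ≡⟨ cong₂ _+_ (sym (∑-distribʳ m 2 twiceOdd)) (*-identityʳ _) ⟩
  ∑≤ m twiceOdd * 2 + twiceOdd (suc m)
    ≡⟨ twiceOdd-partial m ⟩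
  suc m * 2  ∎
  where open ≡-Reasoning

∑-markings≡mults : ∀ k n (h : ℕ → ℕ) r →
  ∑[ m ≤ r ] (if m * k ≤ᵇ n then markings m * h (n ∸ m * k) else 0) ≡ h n + 2 * mults h k n r
∑-markings≡mults k n h zero    = refl
∑-markings≡mults k n h (suc r) with suc r * k ≤ᵇ n
... | true  = trans (cong (_+ 2 * h (n ∸ suc r * k)) (∑-markings≡mults k n h r))
                    (regroup (h n) (mults h k n r) (h (n ∸ suc r * k)))
  where
  regroup : ∀ a b c → a + 2 * b + 2 * c ≡ a + 2 * (c + b)
  regroup = solve-∀
... | false = trans (+-identityʳ _) (∑-markings≡mults k n h r)

opb-suc : ∀ n K → opb n (suc K) ≡ opb n K + 2 * mults (λ j → opb j K) (suc K) n n
opb-suc zero    K = refl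
opb-suc (suc n) K = refl

opb-as-dconv : ∀ n K → opb n (suc K) ≡ dconv (suc K) markings (λ j → opb j K) n
opb-as-dconv n K = trans (opb-suc n K) (sym (∑-markings≡mults (suc K) n (λ j → opb j K) n))

-- σ≤ K t = ∑ 2k over k ≤ K with k ∣ t and t/k odd: the coefficient of qᵗ in
-- q (d/dq) log ∏_{k ≤ K} (1 + qᵏ) / (1 - qᵏ).
σ≤ : ℕ → ℕ → ℕ
σ≤ zero    t = 0
σ≤ (suc K) t = σ≤ K t + suc K * dil (suc K) twiceOdd t

-- The new factor C(qᵏ) contributes k Ω(qᵏ) to the logarithmic derivative, since q C′ = Ω C.
opb-rec : ∀ K n → n * opb n K ≡ conv (σ≤ K) (λ t → opb t K) n
opb-rec zero    zero    = refl
opb-rec zero    (suc n) = trans (*-zeroʳ n) (sym (∑-zero (suc n) (λ _ _ → refl)))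
opb-rec (suc K) n = begin
  n * opb n (suc K)
    ≡⟨ cong (n *_) (opb-as-dconv n K) ⟩
  n * dconv k markings P n
    ≡⟨ dconv-leibniz k markings P n ⟩
  dconv k markings (λ t → t * P t) n + k * dconv k (λ m → m * markings m) P n
    ≡⟨ cong₂ (λ u v → u + k * v) (dconv-congʳ k markings n (λ t _ → opb-rec K t))
                                 (dconv-congˡ k P n (λ m _ → sym (conv-twiceOdd-markings m))) ⟩
  dconv k markings (conv (σ≤ K) P) n + k * dconv k (conv twiceOdd markings) P n
    ≡⟨ cong₂ (λ u v → u + k * v) (dconv-conv-comm k markings (σ≤ K) P n) (dconv-assoc k twiceOdd markings P n) ⟩
  conv (σ≤ K) P′ n + k * dconv k twiceOdd P′ n
    ≡⟨ cong (λ v → conv (σ≤ K) P′ n + k * v) (dconv-as-conv k twiceOdd P′ n) ⟩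
  conv (σ≤ K) P′ n + k * conv (dil k twiceOdd) P′ n
    ≡⟨ conv-linearˡ (σ≤ K) k (dil k twiceOdd) P′ n ⟨
  conv (σ≤ k) P′ n
    ≡⟨ conv-congʳ (σ≤ k) n (λ t _ → opb-as-dconv t K) ⟨
  conv (σ≤ k) (λ t → opb t k) n  ∎
  where
  open ≡-Reasoning
  k = suc K
  P P′ : ℕ → ℕ
  P t = opb t K
  P′ = dconv k markings P

σ : ℕ → ℕ
σ t = σ≤ t t

dil-≤ : ∀ k .{{_ : NonZero k}} x {B} → (∀ d → x d ≤ B) → ∀ t → dil k x t ≤ B
dil-≤ k x {B} x≤B t = partial t
  where
  partial : ∀ M → ∑[ d ≤ M ] (if d * k ≡ᵇ t then x d else 0) ≤ B
  partial zero with 0 ≡ᵇ t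
  ... | true  = x≤B 0
  ... | false = z≤n
  partial (suc M) with suc M * k ≡ᵇ t | ≡ᵇ-reflects-≡ (suc M * k) t
  ... | false | _       = subst (_≤ B) (sym (+-identityʳ _)) (partial M)
  ... | true  | ofʸ hit = subst (_≤ B) (cong (_+ x (suc M)) (sym (∑-zero M miss))) (x≤B (suc M))
    where
    miss : ∀ d → d ≤ M → (if d * k ≡ᵇ t then x d else 0) ≡ 0
    miss d d≤M = if-≢ᵇ (λ d*k≡t → <⇒≢ (*-monoˡ-< k (s≤s d≤M)) (trans d*k≡t (sym hit)))

dil-below : ∀ k x → x 0 ≡ 0 → ∀ t → t < k → dil k x t ≡ 0
dil-below k x x₀≡0 t t<k = ∑-zero t term
  where
  term : ∀ d → d ≤ t → (if d * k ≡ᵇ t then x d else 0) ≡ 0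
  term zero    _ rewrite x₀≡0 = if-eta (0 ≡ᵇ t)
  term (suc d) _ = if-≢ᵇ (λ eq → <⇒≱ t<k (subst (k ≤_) eq (m≤m+n k (d * k))))

σ≤-stable : ∀ {t} K → t ≤ K → σ≤ K t ≡ σ t
σ≤-stable zero    z≤n = refl
σ≤-stable {t} (suc K) t≤1+K with m≤n⇒m<n∨m≡n t≤1+K
... | inj₂ refl  = refl
... | inj₁ t<1+K = begin
  σ≤ K t + suc K * dil (suc K) twiceOdd t
    ≡⟨ cong (λ v → σ≤ K t + suc K * v) (dil-below (suc K) twiceOdd refl t t<1+K) ⟩
  σ≤ K t + suc K * 0
    ≡⟨ trans (cong (σ≤ K t +_) (*-zeroʳ (suc K))) (+-identityʳ _) ⟩
  σ≤ K t
    ≡⟨ σ≤-stable K (≤-pred t<1+K) ⟩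
  σ t  ∎
  where open ≡-Reasoning

σ≤-≤ : ∀ K t → σ≤ K t ≤ K * suc K
σ≤-≤ zero    t = z≤n
σ≤-≤ (suc K) t = begin
  σ≤ K t + suc K * dil (suc K) twiceOdd t
    ≤⟨ +-mono-≤ (σ≤-≤ K t) (*-monoʳ-≤ (suc K) (dil-≤ (suc K) twiceOdd twiceOdd-≤-2 t)) ⟩
  K * suc K + suc K * 2
    ≡⟨ triangle K ⟩
  suc K * suc (suc K)  ∎
  where
  open ≤-Reasoning
  twiceOdd-≤-2 : ∀ d → twiceOdd d ≤ 2
  twiceOdd-≤-2 zero          = z≤n
  twiceOdd-≤-2 (suc zero)    = ≤-refl
  twiceOdd-≤-2 (suc (suc d)) = twiceOdd-≤-2 d
  triangle : ∀ K → K * suc K + suc K * 2 ≡ suc K * suc (suc K)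
  triangle = solve-∀

σ-≤ : ∀ t → σ t ≤ t * suc t
σ-≤ t = σ≤-≤ t t

σ-≥ : ∀ t → 2 * t ≤ σ t
σ-≥ zero    = z≤n
σ-≥ (suc t) = begin
  2 * suc t                                 ≡⟨ *-comm 2 (suc t) ⟩
  suc t * 2                                 ≤⟨ *-monoʳ-≤ (suc t) divisor-one ⟩
  suc t * dil (suc t) twiceOdd (suc t)      ≤⟨ m≤n+m _ (σ≤ t (suc t)) ⟩
  σ (suc t)                                 ∎
  where
  open ≤-Reasoning
  divisor-one : 2 ≤ dil (suc t) twiceOdd (suc t)
  divisor-one = subst (_≤ dil (suc t) twiceOdd (suc t)) (if-≡ᵇ (*-identityˡ (suc t)))
                      (∑-term-≤ (suc t) (λ d → if d * suc t ≡ᵇ suc t then twiceOdd d else 0) (s≤s z≤n))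

opb-zero : ∀ K → opb 0 K ≡ 1
opb-zero zero    = refl
opb-zero (suc K) = trans (+-identityʳ (opb 0 K)) (opb-zero K)

mults-below : ∀ (h : ℕ → ℕ) k n r → n < k → mults h k n r ≡ 0
mults-below h k n zero    n<k = refl
mults-below h k n (suc r) n<k =
  cong₂ _+_ (if-≰ᵇ (<⇒≱ (<-≤-trans n<k (m≤m+n k (r * k))))) (mults-below h k n r n<k)

p̄ : ℕ → ℕ
p̄ = overpartitions

opb-stable : ∀ {m} K → m ≤ K → opb m K ≡ p̄ m
opb-stable zero    z≤n = refl
opb-stable {m} (suc K) m≤1+K with m≤n⇒m<n∨m≡n m≤1+K
... | inj₂ refl  = refl
... | inj₁ m<1+K = begin
  opb m (suc K)
    ≡⟨ opb-suc m K ⟩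
  opb m K + 2 * mults (λ j → opb j K) (suc K) m m
    ≡⟨ cong (λ v → opb m K + 2 * v) (mults-below _ (suc K) m m m<1+K) ⟩
  opb m K + 0
    ≡⟨ +-identityʳ _ ⟩
  opb m K
    ≡⟨ opb-stable K (≤-pred m<1+K) ⟩
  p̄ m  ∎
  where open ≡-Reasoning

p̄-rec : ∀ n → n * p̄ n ≡ ∑[ t ≤ n ] (σ t * p̄ (n ∸ t))
p̄-rec n = trans (opb-rec n n) (∑-cong n λ t t≤n →
  cong₂ _*_ (σ≤-stable n t≤n) (opb-stable n (m∸n≤m n t)))

conv-opb₀ : ∀ x n → conv x (λ j → opb j 0) n ≡ x n
conv-opb₀ x zero    = *-identityʳ (x 0)
conv-opb₀ x (suc n) = begin
  ∑[ t ≤ n ] (x t * opb (suc n ∸ t) 0) + x (suc n) * opb (n ∸ n) 0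
    ≡⟨ cong₂ _+_ (∑-zero n (λ t t≤n → trans (cong (λ s → x t * opb s 0) (+-∸-assoc 1 t≤n)) (*-zeroʳ (x t))))
                 (trans (cong (λ s → x (suc n) * opb s 0) (n∸n≡0 n)) (*-identityʳ (x (suc n)))) ⟩
  x (suc n)  ∎
  where open ≡-Reasoning

opb-one : ∀ n → opb n 1 ≡ markings n
opb-one n = begin
  opb n 1                                   ≡⟨ opb-as-dconv n 0 ⟩
  dconv 1 markings (λ j → opb j 0) n        ≡⟨ conv-as-dconv markings (λ j → opb j 0) n ⟨
  conv markings (λ j → opb j 0) n           ≡⟨ conv-opb₀ markings n ⟩
  markings n                                ∎
  where open ≡-Reasoning

opb-mono : ∀ K n → opb n (suc K) ≤ opb (suc n) (suc K)
opb-mono zero n rewrite opb-one n | opb-one (suc n) = markings-mono n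
  where
  markings-mono : ∀ n → markings n ≤ markings (suc n)
  markings-mono zero    = s≤s z≤n
  markings-mono (suc n) = ≤-refl
opb-mono (suc K) n rewrite opb-as-dconv n (suc K) | opb-as-dconv (suc n) (suc K) =
  dconv-mono (suc (suc K)) markings _ n (opb-mono K)

mults-≥ : ∀ (h : ℕ → ℕ) {k n} r → k ≤ n → h (n ∸ k) ≤ mults h k n (suc r)
mults-≥ h {k} {n} zero    k≤n = begin
  h (n ∸ k)                                               ≡⟨ cong (λ s → h (n ∸ s)) (*-identityˡ k) ⟨
  h (n ∸ 1 * k)                                           ≡⟨ if-≤ᵇ (subst (_≤ n) (sym (*-identityˡ k)) k≤n) ⟨
  (if 1 * k ≤ᵇ n then h (n ∸ 1 * k) else 0)               ≤⟨ m≤m+n _ 0 ⟩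
  mults h k n 1                                           ∎
  where open ≤-Reasoning
mults-≥ h {k} {n} (suc r) k≤n =
  ≤-trans (mults-≥ h r k≤n) (m≤n+m (mults h k n (suc r)) (if suc (suc r) * k ≤ᵇ n then h (n ∸ suc (suc r) * k) else 0))

p̄-step : ∀ m → p̄ (suc m) + 2 ≤ p̄ (suc (suc m))
p̄-step m = +-mono-≤ (opb-mono m (suc m)) (*-monoʳ-≤ 2 first-multiple)
  where
  first-multiple : 1 ≤ mults (λ j → opb j (suc m)) (suc (suc m)) (suc (suc m)) (suc (suc m))
  first-multiple = subst (_≤ mults (λ j → opb j (suc m)) (suc (suc m)) (suc (suc m)) (suc (suc m)))
                         (trans (cong (λ s → opb s (suc m)) (n∸n≡0 (suc m))) (opb-zero (suc m)))
                         (mults-≥ (λ j → opb j (suc m)) {suc (suc m)} (suc m) ≤-refl)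

p̄-pos : ∀ m → 1 ≤ p̄ m
p̄-pos zero          = s≤s z≤n
p̄-pos (suc zero)    = s≤s z≤n
p̄-pos (suc (suc m)) =
  ≤-trans (p̄-pos (suc m)) (≤-trans (m≤m+n _ 2) (p̄-step m))

-- Growth of p̄ and submultiplicativity

∑σ-≥ : ∀ b → b * suc b ≤ ∑≤ b σ
∑σ-≥ zero    = z≤n
∑σ-≥ (suc b) = begin
  suc b * suc (suc b)          ≡⟨ split b ⟩
  b * suc b + 2 * suc b        ≤⟨ +-mono-≤ (∑σ-≥ b) (σ-≥ (suc b)) ⟩
  ∑≤ b σ + σ (suc b)           ∎
  where
  open ≤-Reasoning
  split : ∀ b → suc b * suc (suc b) ≡ b * suc b + 2 * suc b
  split = solve-∀

p̄-weighted-step : ∀ n → 1 ≤ n → n * p̄ n + 2 * (n * n + n + 1) ≤ suc n * p̄ (suc n)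
p̄-weighted-step (suc b) _ = begin
  suc b * p̄ (suc b) + 2 * (suc b * suc b + suc b + 1)
    ≡⟨ cong (_+ 2 * (suc b * suc b + suc b + 1)) (p̄-rec (suc b)) ⟩
  X + σ (suc b) * p̄ (b ∸ b) + 2 * (suc b * suc b + suc b + 1)
    ≡⟨ cong (λ s → X + σ (suc b) * p̄ s + 2 * (suc b * suc b + suc b + 1)) (n∸n≡0 b) ⟩
  X + σ (suc b) * 1 + 2 * (suc b * suc b + suc b + 1)
    ≡⟨ cong (X + σ (suc b) * 1 +_) (constant b) ⟩
  X + σ (suc b) * 1 + (2 * (b * suc b) + 2 * suc b + 2 * suc (suc b))
    ≤⟨ +-monoʳ-≤ (X + σ (suc b) * 1)
                 (+-mono-≤ (+-mono-≤ (*-monoʳ-≤ 2 (∑σ-≥ b)) (σ-≥ (suc b))) (σ-≥ (suc (suc b)))) ⟩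
  X + σ (suc b) * 1 + (2 * ∑≤ b σ + σ (suc b) + σ (suc (suc b)))
    ≡⟨ regroup X (σ (suc b)) (∑≤ b σ) (σ (suc (suc b))) ⟩
  X + 2 * ∑≤ b σ + σ (suc b) * 2 + σ (suc (suc b)) * 1
    ≤⟨ +-monoˡ-≤ _ (+-monoˡ-≤ _ X+2∑σ≤Y) ⟩
  Y + σ (suc b) * 2 + σ (suc (suc b)) * 1
    ≡⟨ cong₂ (λ s r → Y + σ (suc b) * p̄ s + σ (suc (suc b)) * p̄ r) (m+n∸n≡m 1 b) (n∸n≡0 b) ⟨
  Y + σ (suc b) * p̄ (suc b ∸ b) + σ (suc (suc b)) * p̄ (b ∸ b)
    ≡⟨ p̄-rec (suc (suc b)) ⟨
  suc (suc b) * p̄ (suc (suc b))  ∎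
  where
  open ≤-Reasoning
  X Y : ℕ
  X = ∑[ t ≤ b ] (σ t * p̄ (suc b ∸ t))
  Y = ∑[ t ≤ b ] (σ t * p̄ (suc (suc b) ∸ t))
  constant : ∀ b → 2 * (suc b * suc b + suc b + 1) ≡ 2 * (b * suc b) + 2 * suc b + 2 * suc (suc b)
  constant = solve-∀
  regroup : ∀ x s σ s₂ → x + s * 1 + (2 * σ + s + s₂) ≡ x + 2 * σ + s * 2 + s₂ * 1
  regroup = solve-∀
  X+2∑σ≤Y : X + 2 * ∑≤ b σ ≤ Y
  X+2∑σ≤Y = begin
    X + 2 * ∑≤ b σ                                  ≡⟨ cong (X +_) (∑-distribˡ b 2 σ) ⟩
    X + ∑[ t ≤ b ] (2 * σ t)                        ≡⟨ ∑-distrib-+ b ⟨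
    ∑[ t ≤ b ] (σ t * p̄ (suc b ∸ t) + 2 * σ t)      ≤⟨ ∑-mono-≤ b termwise ⟩
    Y                                               ∎
    where
    factor : ∀ s p → s * p + 2 * s ≡ s * (p + 2)
    factor = solve-∀
    termwise : ∀ t → t ≤ b → σ t * p̄ (suc b ∸ t) + 2 * σ t ≤ σ t * p̄ (suc (suc b) ∸ t)
    termwise t t≤b = begin
      σ t * p̄ (suc b ∸ t) + 2 * σ t        ≡⟨ cong (λ s → σ t * p̄ s + 2 * σ t) (+-∸-assoc 1 t≤b) ⟩
      σ t * p̄ (suc (b ∸ t)) + 2 * σ t      ≡⟨ factor (σ t) _ ⟩
      σ t * (p̄ (suc (b ∸ t)) + 2)          ≤⟨ *-monoʳ-≤ (σ t) (p̄-step (b ∸ t)) ⟩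
      σ t * p̄ (suc (suc (b ∸ t)))          ≡⟨ cong (λ s → σ t * p̄ s) (+-∸-assoc 2 t≤b) ⟨
      σ t * p̄ (suc (suc b) ∸ t)            ∎

p̄-lower-bound : ∀ a → 5 ≤ a → suc a * suc (suc a) < 2 * p̄ a
p̄-lower-bound _ (s≤s (s≤s (s≤s (s≤s (s≤s (z≤n {zero})))))) = ≤ᵇ⇒≤ _ _ tt
p̄-lower-bound _ (s≤s (s≤s (s≤s (s≤s (s≤s (z≤n {suc m})))))) = *-cancelˡ-< (6 + m) _ _ (weighted m)
  where
  expand : ∀ m → (7 + m) * ((8 + m) * (9 + m)) ≡ (6 + m) * ((7 + m) * (8 + m)) + 3 * ((7 + m) * (8 + m))
  expand = solve-∀
  slack : ∀ m → 3 * ((7 + m) * (8 + m)) + (m * m + 7 * m + 4) ≡ 2 * (2 * ((6 + m) * (6 + m) + (6 + m) + 1))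
  slack = solve-∀
  regroup : ∀ n p q → n * (2 * p) + 2 * q ≡ 2 * (n * p + q)
  regroup = solve-∀
  -- The step needs n² ≥ 5n + 2, which first holds at n = 6.
  weighted : ∀ m → (6 + m) * ((7 + m) * (8 + m)) < (6 + m) * (2 * p̄ (6 + m))
  weighted zero    = ≤ᵇ⇒≤ _ _ tt
  weighted (suc m) = begin-strict
    (7 + m) * ((8 + m) * (9 + m))
      ≡⟨ expand m ⟩
    (6 + m) * ((7 + m) * (8 + m)) + 3 * ((7 + m) * (8 + m))
      <⟨ +-monoˡ-< _ (weighted m) ⟩
    (6 + m) * (2 * p̄ (6 + m)) + 3 * ((7 + m) * (8 + m))
      ≤⟨ +-monoʳ-≤ _ (≤-trans (m≤m+n _ _) (≤-reflexive (slack m))) ⟩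
    (6 + m) * (2 * p̄ (6 + m)) + 2 * (2 * ((6 + m) * (6 + m) + (6 + m) + 1))
      ≡⟨ regroup (6 + m) (p̄ (6 + m)) (2 * ((6 + m) * (6 + m) + (6 + m) + 1)) ⟩
    2 * ((6 + m) * p̄ (6 + m) + 2 * ((6 + m) * (6 + m) + (6 + m) + 1))
      ≤⟨ *-monoʳ-≤ 2 (p̄-weighted-step (6 + m) (s≤s z≤n)) ⟩
    2 * ((7 + m) * p̄ (7 + m))
      ≡⟨ *-left-comm 2 (7 + m) (p̄ (7 + m)) ⟩
    (7 + m) * (2 * p̄ (7 + m))  ∎
    where open ≤-Reasoning

σ-shift-< : ∀ a i → 5 ≤ a → suc i ≤ a → σ (a + suc i) < p̄ a * σ (suc i)
σ-shift-< a i 5≤a i<a = begin-strict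
  σ (a + suc i)                  ≤⟨ σ-≤ (a + suc i) ⟩
  (a + suc i) * suc (a + suc i)  ≤⟨ spread ⟩
  suc i * (suc a * suc (suc a))  <⟨ *-monoʳ-< (suc i) (p̄-lower-bound a 5≤a) ⟩
  suc i * (2 * p̄ a)              ≡⟨ reorder (suc i) (p̄ a) ⟩
  2 * suc i * p̄ a                ≤⟨ *-monoˡ-≤ (p̄ a) (σ-≥ (suc i)) ⟩
  σ (suc i) * p̄ a                ≡⟨ *-comm (σ (suc i)) (p̄ a) ⟩
  p̄ a * σ (suc i)                ∎
  where
  open ≤-Reasoning
  reorder : ∀ j p → j * (2 * p) ≡ 2 * j * p
  reorder = solve-∀
  expand : ∀ a i → (a + suc i) * suc (a + suc i) ≡ suc a * suc (suc a) + i * (2 * a + 2 + suc i)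
  expand = solve-∀
  collect : ∀ a i → suc a * suc (suc a) + i * (2 * a + 2 + (a + a * a)) ≡ suc i * (suc a * suc (suc a))
  collect = solve-∀
  spread : (a + suc i) * suc (a + suc i) ≤ suc i * (suc a * suc (suc a))
  spread = begin
    (a + suc i) * suc (a + suc i)
      ≡⟨ expand a i ⟩
    suc a * suc (suc a) + i * (2 * a + 2 + suc i)
      ≤⟨ +-monoʳ-≤ _ (*-monoʳ-≤ i (+-monoʳ-≤ (2 * a + 2) (≤-trans i<a (m≤m+n a (a * a))))) ⟩
    suc a * suc (suc a) + i * (2 * a + 2 + (a + a * a))
      ≡⟨ collect a i ⟩
    suc i * (suc a * suc (suc a))  ∎

SubmultiplicativeBelow : ℕ → Set
SubmultiplicativeBelow n = ∀ x y → x + y < n → p̄ (x + y) ≤ p̄ x * p̄ y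

p̄-strictly-submultiplicative : ∀ a b → 5 ≤ a → 1 ≤ b → b ≤ a → SubmultiplicativeBelow (a + b) →
  p̄ (a + b) < p̄ a * p̄ b
p̄-strictly-submultiplicative a (suc b) 5≤a _ b<a below = *-cancelˡ-< n _ _ (begin-strict
  n * p̄ n                                             ≡⟨ p̄-rec n ⟩
  ∑≤ n F                                              ≡⟨ ∑-split a b F ⟩
  ∑≤ a F + ∑[ i ≤ b ] F (a + suc i)                   <⟨ +-mono-≤-< head tail ⟩
  a * p̄ a * p̄ (suc b) + p̄ a * (suc b * p̄ (suc b))    ≡⟨ collect a b (p̄ a) (p̄ (suc b)) ⟩
  n * (p̄ a * p̄ (suc b))                               ∎)
  where
  open ≤-Reasoning
  n = a + suc b
  F : ℕ → ℕ
  F t = σ t * p̄ (n ∸ t)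
  collect : ∀ a b x y → a * x * y + x * (suc b * y) ≡ (a + suc b) * (x * y)
  collect = solve-∀
  head-term : ∀ t → t ≤ a → F t ≤ σ t * p̄ (a ∸ t) * p̄ (suc b)
  head-term zero    _   = z≤n
  head-term (suc t) t<a = begin
    σ (suc t) * p̄ (n ∸ suc t)                   ≡⟨ cong (λ s → σ (suc t) * p̄ s) (+-∸-comm (suc b) t<a) ⟩
    σ (suc t) * p̄ (a ∸ suc t + suc b)           ≤⟨ *-monoʳ-≤ (σ (suc t)) (below (a ∸ suc t) (suc b) smaller) ⟩
    σ (suc t) * (p̄ (a ∸ suc t) * p̄ (suc b))     ≡⟨ *-assoc (σ (suc t)) _ _ ⟨
    σ (suc t) * p̄ (a ∸ suc t) * p̄ (suc b)       ∎
    where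
    smaller : a ∸ suc t + suc b < n
    smaller = +-monoˡ-< (suc b) (∸-monoʳ-< {o = 0} (s≤s z≤n) t<a)
  head : ∑≤ a F ≤ a * p̄ a * p̄ (suc b)
  head = begin
    ∑≤ a F                                       ≤⟨ ∑-mono-≤ a head-term ⟩
    ∑[ t ≤ a ] (σ t * p̄ (a ∸ t) * p̄ (suc b))     ≡⟨ ∑-distribʳ a (p̄ (suc b)) _ ⟨
    ∑[ t ≤ a ] (σ t * p̄ (a ∸ t)) * p̄ (suc b)     ≡⟨ cong (_* p̄ (suc b)) (p̄-rec a) ⟨
    a * p̄ a * p̄ (suc b)                         ∎
  tail-term : ∀ i → i ≤ b → F (a + suc i) < p̄ a * (σ (suc i) * p̄ (b ∸ i))
  tail-term i i≤b = begin-strict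
    σ (a + suc i) * p̄ (n ∸ (a + suc i))
      ≡⟨ cong (λ s → σ (a + suc i) * p̄ s) ([m+n]∸[m+o]≡n∸o a (suc b) (suc i)) ⟩
    σ (a + suc i) * p̄ (b ∸ i)
      <⟨ *-monoˡ-< (p̄ (b ∸ i)) {{>-nonZero (p̄-pos (b ∸ i))}} (σ-shift-< a i 5≤a (≤-trans (s≤s i≤b) b<a)) ⟩
    p̄ a * σ (suc i) * p̄ (b ∸ i)
      ≡⟨ *-assoc (p̄ a) _ _ ⟩
    p̄ a * (σ (suc i) * p̄ (b ∸ i))  ∎
  tail : ∑[ i ≤ b ] F (a + suc i) < p̄ a * (suc b * p̄ (suc b))
  tail = begin-strict
    ∑[ i ≤ b ] F (a + suc i)                     <⟨ ∑-mono-< b tail-term ⟩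
    ∑[ i ≤ b ] (p̄ a * (σ (suc i) * p̄ (b ∸ i)))   ≡⟨ ∑-distribˡ b (p̄ a) _ ⟨
    p̄ a * ∑[ i ≤ b ] (σ (suc i) * p̄ (b ∸ i))     ≡⟨ cong (p̄ a *_) (trans (p̄-rec (suc b)) (∑-head b _)) ⟨
    p̄ a * (suc b * p̄ (suc b))                    ∎

p̄-small-cases : ∀ a b → a ≤ 4 → 1 ≤ b → b ≤ a →
  (a , b) ≡ (1 , 1) ⊎ (a , b) ≡ (2 , 1) ⊎ p̄ (a + b) < p̄ a * p̄ b
p̄-small-cases 1 1 _ _ _ = inj₁ refl
p̄-small-cases 2 1 _ _ _ = inj₂ (inj₁ refl)
p̄-small-cases 2 2 _ _ _ = inj₂ (inj₂ (≤ᵇ⇒≤ _ _ tt))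
p̄-small-cases 3 1 _ _ _ = inj₂ (inj₂ (≤ᵇ⇒≤ _ _ tt))
p̄-small-cases 3 2 _ _ _ = inj₂ (inj₂ (≤ᵇ⇒≤ _ _ tt))
p̄-small-cases 3 3 _ _ _ = inj₂ (inj₂ (≤ᵇ⇒≤ _ _ tt))
p̄-small-cases 4 1 _ _ _ = inj₂ (inj₂ (≤ᵇ⇒≤ _ _ tt))
p̄-small-cases 4 2 _ _ _ = inj₂ (inj₂ (≤ᵇ⇒≤ _ _ tt))
p̄-small-cases 4 3 _ _ _ = inj₂ (inj₂ (≤ᵇ⇒≤ _ _ tt))
p̄-small-cases 4 4 _ _ _ = inj₂ (inj₂ (≤ᵇ⇒≤ _ _ tt))
p̄-small-cases 1 (suc (suc _)) _ _ (s≤s ())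
p̄-small-cases 2 (suc (suc (suc _))) _ _ (s≤s (s≤s ()))
p̄-small-cases 3 (suc (suc (suc (suc _)))) _ _ (s≤s (s≤s (s≤s ())))
p̄-small-cases 4 (suc (suc (suc (suc (suc _))))) _ _ (s≤s (s≤s (s≤s (s≤s ()))))
p̄-small-cases (suc (suc (suc (suc (suc _))))) _ (s≤s (s≤s (s≤s (s≤s ())))) _ _

p̄-submultiplicative-ordered : ∀ a b → b ≤ a → SubmultiplicativeBelow (a + b) → p̄ (a + b) ≤ p̄ a * p̄ b
p̄-submultiplicative-ordered a zero    _   _ rewrite +-identityʳ a | *-identityʳ (p̄ a) = ≤-refl
p̄-submultiplicative-ordered a (suc b) b<a below with 5 ≤? a
... | yes 5≤a = <⇒≤ (p̄-strictly-submultiplicative a (suc b) 5≤a (s≤s z≤n) b<a below)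
... | no  5≰a with p̄-small-cases a (suc b) (≤-pred (≰⇒> 5≰a)) (s≤s z≤n) b<a
...   | inj₁ refl        = ≤-refl
...   | inj₂ (inj₁ refl) = ≤-refl
...   | inj₂ (inj₂ p<)   = <⇒≤ p<

p̄-submultiplicative-step : ∀ x y → SubmultiplicativeBelow (x + y) → p̄ (x + y) ≤ p̄ x * p̄ y
p̄-submultiplicative-step x y below with y ≤? x
... | yes y≤x = p̄-submultiplicative-ordered x y y≤x below
... | no  y≰x = subst₂ (λ s p → p̄ s ≤ p) (+-comm y x) (*-comm (p̄ y) (p̄ x))
                  (p̄-submultiplicative-ordered y x (<⇒≤ (≰⇒> y≰x)) (subst SubmultiplicativeBelow (+-comm x y) below))

p̄-submultiplicative-below : ∀ n → SubmultiplicativeBelow n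
p̄-submultiplicative-below (suc n) x y x+y<1+n with m≤n⇒m<n∨m≡n (≤-pred x+y<1+n)
... | inj₁ x+y<n = p̄-submultiplicative-below n x y x+y<n
... | inj₂ refl  = p̄-submultiplicative-step x y (p̄-submultiplicative-below (x + y))

theorem1p3 : (a b : ℕ) → 1 ≤ b → b ≤ a →
    ¬ ((a , b) ≡ (1 , 1)) → ¬ ((a , b) ≡ (2 , 1)) →
    overpartitions a * overpartitions b > overpartitions (a + b)
theorem1p3 a b 1≤b b≤a ≢[1,1] ≢[2,1] with 5 ≤? a
... | yes 5≤a = p̄-strictly-submultiplicative a b 5≤a 1≤b b≤a (p̄-submultiplicative-below (a + b))
... | no  5≰a with p̄-small-cases a b (≤-pred (≰⇒> 5≰a)) 1≤b b≤a
...   | inj₁ [1,1]        = contradiction [1,1] ≢[1,1]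
...   | inj₂ (inj₁ [2,1]) = contradiction [2,1] ≢[2,1]
...   | inj₂ (inj₂ p<)    = p<
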